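{- Every affine impartial form $G\in\mathbb{Im}^\infty$ equals, modulo $\mathbb{Im}^\infty$, either a nimber $*n$ or the moon, i.e. the game $\{\infty\,|\,\overline{\infty}\}$.
   Context: Affine normal play forms $\mathbb{Np}^\infty$ are built recursively from two terminating games $\infty$ (Left wins; outcome $\mathscr{L}$) and $\overline{\infty}$ (Right wins; outcome $\mathscr{R}$), with $\infty+X=\infty$ for $X\neq\overline{\infty}$ and $\overline{\infty}+X=\overline{\infty}$ for $X\neq\infty$; the normal play zero is $0=\{\overline{\infty}\,|\,\infty\}$. A form $G\notin\{\infty,\overline{\infty}\}$ is a Left-check if $\infty$ is a Left option (Right-check if $\overline{\infty}$ is a Right option); it is quiet if it is neither $\infty,\overline{\infty}$ nor a check. The conjugate $\overline{G}$ swaps the roles of the players (swapping $\infty$ and $\overline{\infty}$). $G$ is symmetric if $G\notin\{\infty,\overline{\infty}\}$ and its Right options are exactly the conjugates of its Left options. $G$ is affine impartial ($G\in\mathbb{Im}^\infty$) if $G$ and all its quiet followers are symmetric. For $G,H\in\mathbb{Im}^\infty$, $G=_{\mathbb{Im}^\infty}H$ means $o(G+X)=o(H+X)$ for every $X\in\mathbb{Im}^\infty$, where $o$ denotes the outcome class among $\mathscr{L},\mathscr{N},\mathscr{P},\mathscr{R}$. -}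

module Defs where

open import Data.Nat using (ℕ; zero; suc; _+_)
open import Data.Fin using (Fin; zero; suc; splitAt; fromℕ<; toℕ)
open import Data.Fin as Fin using ()
open import Data.Bool using (Bool; true; false; not; _∨_; _∧_)
open import Data.Sum using (_⊎_; [_,_])
open import Data.Product using (Σ; _×_; _,_; ∃)
open import Data.Unit using (⊤)
open import Data.Empty using (⊥)
open import Relation.Nullary using (¬_)
open import Relation.Binary.PropositionalEquality using (_≡_)

-- Affine normal play forms.  A non-atomic form {G^L | G^R} has finitely
-- many Left options (indexed by Fin m) and Right options (indexed by Fin n);
-- options may themselves be the atoms ∞ / ∞̄.
data Form : Set where
  ∞    : Form
  ∞̄    : Form
  node : (m : ℕ) → (Fin m → Form) → (n : ℕ) → (Fin n → Form) → Form

-- Identity of forms, with option collections read as sets.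
_≅_ : Form → Form → Set
∞ ≅ ∞ = ⊤
∞̄ ≅ ∞̄ = ⊤
node m L n R ≅ node m' L' n' R' =
  ((i : Fin m) → Σ (Fin m') λ i' → L i ≅ L' i') ×
  ((i' : Fin m') → Σ (Fin m) λ i → L i ≅ L' i') ×
  ((j : Fin n) → Σ (Fin n') λ j' → R j ≅ R' j') ×
  ((j' : Fin n') → Σ (Fin n) λ j → R j ≅ R' j')
_ ≅ _ = ⊥

conj : Form → Form
conj ∞ = ∞̄
conj ∞̄ = ∞
conj (node m L n R) = node n (λ j → conj (R j)) m (λ i → conj (L i))

-- The sum ∞ + ∞̄ is not defined in the paper; it never arises for the
-- sums of non-atomic forms considered below, and is set to ∞ arbitrarily.
infixl 6 _⊕_
_⊕_ : Form → Form → Form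
∞ ⊕ _ = ∞
∞̄ ⊕ ∞ = ∞
∞̄ ⊕ ∞̄ = ∞̄
∞̄ ⊕ node _ _ _ _ = ∞̄
node _ _ _ _ ⊕ ∞ = ∞
node _ _ _ _ ⊕ ∞̄ = ∞̄
G@(node m L n R) ⊕ H@(node m' L' n' R') =
  node (m + m') ([ (λ i → L i ⊕ H) , (λ i' → G ⊕ L' i') ] ∘ splitAt m)
       (n + n') ([ (λ j → R j ⊕ H) , (λ j' → G ⊕ R' j') ] ∘ splitAt n)
  where
  _∘_ : {A B C : Set} → (B → C) → (A → B) → A → C
  (f ∘ g) x = f (g x)

anyFin : (m : ℕ) → (Fin m → Bool) → Bool
anyFin zero f = false
anyFin (suc m) f = f zero ∨ anyFin m (λ i → f (suc i))

leftWinsFirst  : Form → Bool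
rightWinsFirst : Form → Bool
leftWinsFirst ∞ = true
leftWinsFirst ∞̄ = false
leftWinsFirst (node m L n R) = anyFin m (λ i → not (rightWinsFirst (L i)))
rightWinsFirst ∞ = false
rightWinsFirst ∞̄ = true
rightWinsFirst (node m L n R) = anyFin n (λ j → not (leftWinsFirst (R j)))

data Outcome : Set where
  𝓛 𝓝 𝓟 𝓡 : Outcome

outcome : Form → Outcome
outcome G with leftWinsFirst G | rightWinsFirst G
... | true  | false = 𝓛
... | true  | true  = 𝓝
... | false | false = 𝓟
... | false | true  = 𝓡

LeftCheck : Form → Set
LeftCheck (node m L n R) = Σ (Fin m) λ i → L i ≡ ∞
LeftCheck _ = ⊥

RightCheck : Form → Set
RightCheck (node m L n R) = Σ (Fin n) λ j → R j ≡ ∞̄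
RightCheck _ = ⊥

Quiet : Form → Set
Quiet (node m L n R) = ¬ LeftCheck (node m L n R) × ¬ RightCheck (node m L n R)
Quiet _ = ⊥

Symmetric : Form → Set
Symmetric (node m L n R) =
  ((j : Fin n) → Σ (Fin m) λ i → R j ≅ conj (L i)) ×
  ((i : Fin m) → Σ (Fin n) λ j → R j ≅ conj (L i))
Symmetric _ = ⊥

QuietFollowersSym : Form → Set
QuietFollowersSym ∞ = ⊤
QuietFollowersSym ∞̄ = ⊤
QuietFollowersSym G@(node m L n R) =
  (Quiet G → Symmetric G) ×
  ((i : Fin m) → QuietFollowersSym (L i)) ×
  ((j : Fin n) → QuietFollowersSym (R j))

IsImp : Form → Set
IsImp G = Symmetric G × QuietFollowersSym G

_≡Im_ : Form → Form → Set
G ≡Im H = (X : Form) → IsImp X → outcome (G ⊕ X) ≡ outcome (H ⊕ X)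

zeroF : Form
zeroF = node 1 (λ _ → ∞̄) 1 (λ _ → ∞)

nim : ℕ → Form
-- nimOpts k i = *(k - i), so that nimOpts k ranges over *0, …, *k.
nimOpts : (k : ℕ) → Fin (suc k) → Form
nim zero = zeroF
nim (suc k) = node (suc k) (nimOpts k) (suc k) (nimOpts k)
nimOpts k zero = nim k
nimOpts (suc k) (suc i) = nimOpts k i

moon : Form
moon = node 1 (λ _ → ∞) 1 (λ _ → ∞̄)

module Submission where

-- Every quiet affine impartial form X gets a value, a nimber value k or a
-- moon value, by a mex rule.  For any form A whose quiet followers are
-- symmetric, the values v for which Left (or Right) wins A ⊕ X moving first,
-- X quiet impartial of value v, form a finite or cofinite set computed from
-- the options of A; this is shown by induction on A and X together, the case
-- of two quiet forms being the mex argument of Sprague–Grundy theory.  Hence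
-- a quiet G behaves as *k if its value is k and as the moon otherwise, while a
-- non-quiet symmetric G has both ∞ and ∞̄ as options, so that, like the moon,
-- it makes every sum with a non-atomic form an 𝓝-position.

open import Defs
open import Data.Bool using (Bool; true; false; not; _∨_; if_then_else_)
open import Data.Bool.Properties using (∨-assoc; ∨-comm; ∨-zeroʳ; ∨-identityʳ; not-involutive; ⇔→≡)
open import Data.Empty using (⊥; ⊥-elim)
open import Data.Fin using (Fin; zero; suc; splitAt; toℕ; fromℕ<)
open import Data.Fin.Properties using (any?; toℕ-fromℕ<)
open import Data.Maybe using (Maybe; just; nothing; _<∣>_)
open import Data.Nat using (ℕ; zero; suc; _+_; _∸_; _⊔_; _≤_; _<_; _≟_; _≤?_; s≤s)
open import Data.Nat.Properties
  using (m⊔n≤o⇒m≤o; m⊔n≤o⇒n≤o; ≤-refl; ≰⇒≥; n<1+n; <⇒≢; >⇒≢; <-cmp; m<1+n⇒m<n∨m≡n; m∸n≤m; m∸[m∸n]≡n)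
open import Data.Product using (Σ; ∃; _×_; _,_; proj₁; proj₂)
open import Data.Sum using (_⊎_; inj₁; inj₂; [_,_]; map₁)
import Data.Sum as Sum
open import Data.Unit using (⊤; tt)
open import Function using (_∘_; _⇔_; mk⇔)
open import Relation.Binary using (tri<; tri≈; tri>)
open import Relation.Binary.PropositionalEquality
  using (_≡_; _≢_; refl; sym; trans; cong; cong₂; subst; module ≡-Reasoning)
open import Relation.Nullary using (¬_; Dec; yes; no; does)
open import Relation.Nullary.Decidable using (dec-true; dec-false; does-⇔; ¬?; _×-dec_)

bool-absurd : ∀ {b} → b ≡ true → b ≡ false → ⊥
bool-absurd refl ()

∨-redundant : ∀ {a b} → a ≡ true ⊎ b ≡ false → a ∨ b ≡ a
∨-redundant (inj₁ refl) = refl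
∨-redundant {a} (inj₂ refl) = ∨-identityʳ a

∨-swapped : ∀ {x y a b a' b'} → x ≡ (a ∨ b) → y ≡ (b' ∨ a') → a ≡ a' → b ≡ b' → x ≡ y
∨-swapped {a' = a'} {b'} x≡ y≡ refl refl = trans x≡ (trans (∨-comm a' b') (sym y≡))

anyFin-intro : ∀ {m} {f : Fin m → Bool} i → f i ≡ true → anyFin m f ≡ true
anyFin-intro {suc m} {f} zero fi = cong (_∨ anyFin m (f ∘ suc)) fi
anyFin-intro {suc m} {f} (suc i) fi = trans (cong (f zero ∨_) (anyFin-intro i fi)) (∨-zeroʳ (f zero))

anyFin-witness : ∀ {m} {f : Fin m → Bool} → anyFin m f ≡ true → ∃ λ i → f i ≡ true
anyFin-witness {suc m} {f} any with f zero in f0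
... | true = zero , f0
... | false with anyFin-witness any
...   | i , fi = suc i , fi

anyFin-covered : ∀ {m m'} {f : Fin m → Bool} {g : Fin m' → Bool} →
  (∀ i → ∃ λ i' → f i ≡ g i') → anyFin m f ≡ true → anyFin m' g ≡ true
anyFin-covered f→g any with anyFin-witness any
... | i , fi = let (i' , e) = f→g i in anyFin-intro i' (trans (sym e) fi)

anyFin-match : ∀ {m m'} {f : Fin m → Bool} {g : Fin m' → Bool} →
  (∀ i → ∃ λ i' → f i ≡ g i') → (∀ i' → ∃ λ i → f i ≡ g i') → anyFin m f ≡ anyFin m' g
anyFin-match f→g g→f =
  ⇔→≡ (mk⇔ (anyFin-covered f→g) (anyFin-covered (λ i' → let (i , e) = g→f i' in i , sym e)))

anyFin-cong : ∀ {m} {f g : Fin m → Bool} → (∀ i → f i ≡ g i) → anyFin m f ≡ anyFin m g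
anyFin-cong f≗g = anyFin-match (λ i → i , f≗g i) (λ i → i , f≗g i)

anyFin-false : ∀ {m} {f : Fin m → Bool} → (∀ i → f i ≡ false) → anyFin m f ≡ false
anyFin-false {zero} _ = refl
anyFin-false {suc m} none = cong₂ _∨_ (none zero) (anyFin-false (none ∘ suc))

anyFin-splitAt : ∀ m m' (f : Fin m ⊎ Fin m' → Bool) →
  anyFin (m + m') (f ∘ splitAt m) ≡ anyFin m (f ∘ inj₁) ∨ anyFin m' (f ∘ inj₂)
anyFin-splitAt zero m' f = refl
anyFin-splitAt (suc m) m' f =
  trans (cong (f (inj₁ zero) ∨_) (anyFin-splitAt m m' (f ∘ map₁ suc))) (sym (∨-assoc (f (inj₁ zero)) _ _))

-- `just k` is the value of the nimber *k.  `nothing` is the value of forms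
-- that behave like the moon: they cancel no value, not even their own.
Value : Set
Value = Maybe ℕ

cancels : Value → Value → Bool
cancels (just a) (just b) = does (a ≟ b)
cancels _ _ = false

-- A set of values whose trace on ℕ is finite or cofinite; `nothing` belongs
-- to it exactly when it is cofinite.
record ValueSet : Set where
  field
    moonIn : Bool
    natIn : ℕ → Bool
    bound : ℕ
    natIn-stable : ∀ {n} → bound ≤ n → natIn n ≡ moonIn

open ValueSet

infix 7 _∈ᵇ_
infix 4 _≈_
_∈ᵇ_ : Value → ValueSet → Bool
nothing ∈ᵇ S = moonIn S
just n ∈ᵇ S = natIn S n

_≈_ : ValueSet → ValueSet → Set
S ≈ T = ∀ v → v ∈ᵇ S ≡ v ∈ᵇ T

≈-sym : ∀ {S T} → S ≈ T → T ≈ S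
≈-sym S≈T v = sym (S≈T v)

≈-trans : ∀ {S T U} → S ≈ T → T ≈ U → S ≈ U
≈-trans S≈T T≈U v = trans (S≈T v) (T≈U v)

full empty : ValueSet
full = record { moonIn = true ; natIn = λ _ → true ; bound = 0 ; natIn-stable = λ _ → refl }
empty = record { moonIn = false ; natIn = λ _ → false ; bound = 0 ; natIn-stable = λ _ → refl }

∁_ : ValueSet → ValueSet
∁ S = record
  { moonIn = not (moonIn S)
  ; natIn = not ∘ natIn S
  ; bound = bound S
  ; natIn-stable = λ le → cong not (natIn-stable S le)
  }

infixr 8 _∪_
_∪_ : ValueSet → ValueSet → ValueSet
S ∪ T = record
  { moonIn = moonIn S ∨ moonIn T
  ; natIn = λ n → natIn S n ∨ natIn T n
  ; bound = bound S ⊔ bound T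
  ; natIn-stable = λ le →
      cong₂ _∨_ (natIn-stable S (m⊔n≤o⇒m≤o _ _ le)) (natIn-stable T (m⊔n≤o⇒n≤o _ _ le))
  }

⋃ : (m : ℕ) → (Fin m → ValueSet) → ValueSet
⋃ zero _ = empty
⋃ (suc m) S = S zero ∪ ⋃ m (S ∘ suc)

nonCancelling : Value → ValueSet
nonCancelling nothing = full
nonCancelling (just k) = record
  { moonIn = true
  ; natIn = λ n → not (does (k ≟ n))
  ; bound = suc k
  ; natIn-stable = λ k<n → cong not (dec-false (k ≟ _) (<⇒≢ k<n))
  }

∈-full : ∀ v → v ∈ᵇ full ≡ true
∈-full nothing = refl
∈-full (just _) = refl

∈-empty : ∀ v → v ∈ᵇ empty ≡ false
∈-empty nothing = refl
∈-empty (just _) = refl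

∈-∁ : ∀ v S → v ∈ᵇ ∁ S ≡ not (v ∈ᵇ S)
∈-∁ nothing S = refl
∈-∁ (just _) S = refl

∈-∪ : ∀ v S T → v ∈ᵇ S ∪ T ≡ (v ∈ᵇ S ∨ v ∈ᵇ T)
∈-∪ nothing S T = refl
∈-∪ (just _) S T = refl

∈-⋃ : ∀ v m (S : Fin m → ValueSet) → v ∈ᵇ ⋃ m S ≡ anyFin m (λ i → v ∈ᵇ S i)
∈-⋃ v zero S = ∈-empty v
∈-⋃ v (suc m) S = trans (∈-∪ v (S zero) _) (cong (v ∈ᵇ S zero ∨_) (∈-⋃ v m (S ∘ suc)))

∈-nonCancelling : ∀ v w → w ∈ᵇ nonCancelling v ≡ not (cancels v w)
∈-nonCancelling nothing w = ∈-full w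
∈-nonCancelling (just k) nothing = refl
∈-nonCancelling (just k) (just n) = refl

∁-cong : ∀ {S T} → S ≈ T → ∁ S ≈ ∁ T
∁-cong {S} {T} S≈T v = trans (∈-∁ v S) (trans (cong not (S≈T v)) (sym (∈-∁ v T)))

⋃-match : ∀ {m m'} {S : Fin m → ValueSet} {T : Fin m' → ValueSet} →
  (∀ i → ∃ λ i' → S i ≈ T i') → (∀ i' → ∃ λ i → S i ≈ T i') → ⋃ m S ≈ ⋃ m' T
⋃-match {m} {m'} {S} {T} S→T T→S v =
  trans (∈-⋃ v m S)
    (trans (anyFin-match (λ i → let (i' , e) = S→T i in i' , e v) (λ i' → let (i , e) = T→S i' in i , e v))
      (sym (∈-⋃ v m' T)))

⋃-cong : ∀ {m} {S T : Fin m → ValueSet} → (∀ i → S i ≈ T i) → ⋃ m S ≈ ⋃ m T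
⋃-cong S≈T = ⋃-match (λ i → i , S≈T i) (λ i → i , S≈T i)

firstFalse : (ℕ → Bool) → ℕ → Maybe ℕ
firstFalse f zero = nothing
firstFalse f (suc k) = firstFalse f k <∣> (if f k then nothing else just k)

data FirstFalse (f : ℕ → Bool) (k : ℕ) : Maybe ℕ → Set where
  found : ∀ {r} → f r ≡ false → (∀ {j} → j < r → f j ≡ true) → FirstFalse f k (just r)
  none : (∀ {j} → j < k → f j ≡ true) → FirstFalse f k nothing

firstFalse-spec : ∀ f k → FirstFalse f k (firstFalse f k)
firstFalse-spec f zero = none λ ()
firstFalse-spec f (suc k) with firstFalse f k | firstFalse-spec f k
... | just r | found fr below = found fr below
... | nothing | none below with f k in fk
...   | false = found fk below
...   | true = none λ j<1+k → [ below , (λ { refl → fk }) ] (m<1+n⇒m<n∨m≡n j<1+k)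

mex : ValueSet → Value
mex S = firstFalse (natIn S) (suc (bound S))

data IsMex (S : ValueSet) : Value → Set where
  mex-nat : ∀ {k} → just k ∈ᵇ S ≡ false → (∀ {j} → j < k → just j ∈ᵇ S ≡ true) → IsMex S (just k)
  mex-moon : (∀ v → v ∈ᵇ S ≡ true) → IsMex S nothing

mex-isMex : ∀ S → IsMex S (mex S)
mex-isMex S with mex S | firstFalse-spec (natIn S) (suc (bound S))
... | just k | found k∉S below = mex-nat k∉S below
... | nothing | none upToBound = mex-moon everything
  where
  moon∈S : moonIn S ≡ true
  moon∈S = trans (sym (natIn-stable S ≤-refl)) (upToBound (n<1+n (bound S)))
  everything : ∀ v → v ∈ᵇ S ≡ true
  everything nothing = moon∈S
  everything (just n) with n ≤? bound S
  ... | yes n≤bound = upToBound (s≤s n≤bound)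
  ... | no n≰bound = trans (natIn-stable S (≰⇒≥ n≰bound)) moon∈S

IsMex-unique : ∀ {S a b} → IsMex S a → IsMex S b → a ≡ b
IsMex-unique (mex-nat {k} k∉S belowk) (mex-nat {l} l∉S belowl) with <-cmp k l
... | tri< k<l _ _ = ⊥-elim (bool-absurd (belowl k<l) k∉S)
... | tri≈ _ refl _ = refl
... | tri> _ _ l<k = ⊥-elim (bool-absurd (belowk l<k) l∉S)
IsMex-unique (mex-nat {k} k∉S _) (mex-moon all) = ⊥-elim (bool-absurd (all (just k)) k∉S)
IsMex-unique (mex-moon all) (mex-nat {l} l∉S _) = ⊥-elim (bool-absurd (all (just l)) l∉S)
IsMex-unique (mex-moon _) (mex-moon _) = refl

IsMex-≈ : ∀ {S T v} → S ≈ T → IsMex S v → IsMex T v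
IsMex-≈ S≈T (mex-nat {k} k∉S below) =
  mex-nat (trans (sym (S≈T (just k))) k∉S) (λ {j} j<k → trans (sym (S≈T (just j))) (below j<k))
IsMex-≈ S≈T (mex-moon all) = mex-moon (λ v → trans (sym (S≈T v)) (all v))

mex-cong : ∀ {S T} → S ≈ T → mex S ≡ mex T
mex-cong {S} {T} S≈T = IsMex-unique (IsMex-≈ S≈T (mex-isMex S)) (mex-isMex T)

-- In a sum of quiet forms of values a = mex S and b = mex T, the mover wins by
-- moving one component to the other's value, which fails only when a and b
-- are the same nimber.
mex-duel : ∀ {S T a b} → IsMex S a → IsMex T b → (b ∈ᵇ S ∨ a ∈ᵇ T) ≡ not (cancels a b)
mex-duel {b = b} (mex-moon allS) _ = cong (_∨ _) (allS b)
mex-duel {S} (mex-nat {k} _ _) (mex-moon allT) = trans (cong (moonIn S ∨_) (allT (just k))) (∨-zeroʳ _)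
mex-duel {S} {T} (mex-nat {k} k∉S belowk) (mex-nat {l} l∉T belowl) with <-cmp k l
... | tri< k<l _ _ =
  trans (cong (natIn S l ∨_) (belowl k<l)) (trans (∨-zeroʳ _) (sym (cong not (dec-false (k ≟ l) (<⇒≢ k<l)))))
... | tri≈ _ refl _ = trans (cong₂ _∨_ k∉S l∉T) (sym (cong not (dec-true (k ≟ k) refl)))
... | tri> _ _ l<k = trans (cong (_∨ natIn T k) (belowk l<k)) (sym (cong not (dec-false (k ≟ l) (>⇒≢ l<k))))

leftWinsFirst-⊕ : ∀ m L n R m' L' n' R' →
  leftWinsFirst (node m L n R ⊕ node m' L' n' R') ≡
    (anyFin m (λ i → not (rightWinsFirst (L i ⊕ node m' L' n' R')))
     ∨ anyFin m' (λ i → not (rightWinsFirst (node m L n R ⊕ L' i))))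
leftWinsFirst-⊕ m L n R m' L' n' R' =
  anyFin-splitAt m m' (λ s → not (rightWinsFirst ([ (λ i → L i ⊕ node m' L' n' R') , (λ i → node m L n R ⊕ L' i) ] s)))

rightWinsFirst-⊕ : ∀ m L n R m' L' n' R' →
  rightWinsFirst (node m L n R ⊕ node m' L' n' R') ≡
    (anyFin n (λ j → not (leftWinsFirst (R j ⊕ node m' L' n' R')))
     ∨ anyFin n' (λ j → not (leftWinsFirst (node m L n R ⊕ R' j))))
rightWinsFirst-⊕ m L n R m' L' n' R' =
  anyFin-splitAt n n' (λ s → not (leftWinsFirst ([ (λ j → R j ⊕ node m' L' n' R') , (λ j → node m L n R ⊕ R' j) ] s)))

⊕-comm-wins : ∀ A B →
  (leftWinsFirst (A ⊕ B) ≡ leftWinsFirst (B ⊕ A)) × (rightWinsFirst (A ⊕ B) ≡ rightWinsFirst (B ⊕ A))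
⊕-comm-wins ∞ ∞ = refl , refl
⊕-comm-wins ∞ ∞̄ = refl , refl
⊕-comm-wins ∞ (node _ _ _ _) = refl , refl
⊕-comm-wins ∞̄ ∞ = refl , refl
⊕-comm-wins ∞̄ ∞̄ = refl , refl
⊕-comm-wins ∞̄ (node _ _ _ _) = refl , refl
⊕-comm-wins (node _ _ _ _) ∞ = refl , refl
⊕-comm-wins (node _ _ _ _) ∞̄ = refl , refl
⊕-comm-wins A@(node m L n R) B@(node m' L' n' R') =
  ∨-swapped (leftWinsFirst-⊕ m L n R m' L' n' R') (leftWinsFirst-⊕ m' L' n' R' m L n R)
    (anyFin-cong λ i → cong not (proj₂ (⊕-comm-wins (L i) B)))
    (anyFin-cong λ i → cong not (proj₂ (⊕-comm-wins A (L' i)))) ,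
  ∨-swapped (rightWinsFirst-⊕ m L n R m' L' n' R') (rightWinsFirst-⊕ m' L' n' R' m L n R)
    (anyFin-cong λ j → cong not (proj₁ (⊕-comm-wins (R j) B)))
    (anyFin-cong λ j → cong not (proj₁ (⊕-comm-wins A (R' j))))

data IsNode : Form → Set where
  is-node : ∀ {m L n R} → IsNode (node m L n R)

IsNode⇒≢∞ : ∀ {X} → IsNode X → X ≢ ∞
IsNode⇒≢∞ is-node ()

IsNode⇒≢∞̄ : ∀ {X} → IsNode X → X ≢ ∞̄
IsNode⇒≢∞̄ is-node ()

_≟∞ : (X : Form) → Dec (X ≡ ∞)
∞ ≟∞ = yes refl
∞̄ ≟∞ = no λ ()
node _ _ _ _ ≟∞ = no λ ()

_≟∞̄ : (X : Form) → Dec (X ≡ ∞̄)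
∞ ≟∞̄ = no λ ()
∞̄ ≟∞̄ = yes refl
node _ _ _ _ ≟∞̄ = no λ ()

leftCheck? : ∀ m L n R → Dec (LeftCheck (node m L n R))
leftCheck? m L n R = any? λ i → L i ≟∞

rightCheck? : ∀ m L n R → Dec (RightCheck (node m L n R))
rightCheck? m L n R = any? λ j → R j ≟∞̄

quiet? : ∀ X → Dec (Quiet X)
quiet? ∞ = no λ ()
quiet? ∞̄ = no λ ()
quiet? (node m L n R) = ¬? (leftCheck? m L n R) ×-dec ¬? (rightCheck? m L n R)

Quiet⇒IsNode : ∀ {X} → Quiet X → IsNode X
Quiet⇒IsNode {node _ _ _ _} _ = is-node

¬Quiet⇒check : ∀ {m L n R} → ¬ Quiet (node m L n R) → LeftCheck (node m L n R) ⊎ RightCheck (node m L n R)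
¬Quiet⇒check {m} {L} {n} {R} loud with leftCheck? m L n R | rightCheck? m L n R
... | yes lc | _ = inj₁ lc
... | no _ | yes rc = inj₂ rc
... | no ¬lc | no ¬rc = ⊥-elim (loud (¬lc , ¬rc))

≅∞ : ∀ {X} → X ≅ ∞ → X ≡ ∞
≅∞ {∞} _ = refl

∞≅ : ∀ {X} → ∞ ≅ X → X ≡ ∞
∞≅ {∞} _ = refl

≅∞̄ : ∀ {X} → X ≅ ∞̄ → X ≡ ∞̄
≅∞̄ {∞̄} _ = refl

∞̄≅ : ∀ {X} → ∞̄ ≅ X → X ≡ ∞̄
∞̄≅ {∞̄} _ = refl

conj≡∞ : ∀ {X} → conj X ≡ ∞ → X ≡ ∞̄
conj≡∞ {∞̄} _ = refl

conj≡∞̄ : ∀ {X} → conj X ≡ ∞̄ → X ≡ ∞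
conj≡∞̄ {∞} _ = refl

≅-quiet : ∀ {m L n R m' L' n' R'} →
  node m L n R ≅ node m' L' n' R' → Quiet (node m L n R) ⇔ Quiet (node m' L' n' R')
≅-quiet {L = L} {R = R} {L' = L'} {R' = R'} (L→L' , L'→L , R→R' , R'→R) = mk⇔
  (λ (¬lc , ¬rc) →
    (λ (i' , e) → let (i , Li≅) = L'→L i' in ¬lc (i , ≅∞ (subst (L i ≅_) e Li≅))) ,
    (λ (j' , e) → let (j , Rj≅) = R'→R j' in ¬rc (j , ≅∞̄ (subst (R j ≅_) e Rj≅))))
  (λ (¬lc' , ¬rc') →
    (λ (i , e) → let (i' , Li≅) = L→L' i in ¬lc' (i' , ∞≅ (subst (_≅ L' i') e Li≅))) ,
    (λ (j , e) → let (j' , Rj≅) = R→R' j in ¬rc' (j' , ∞̄≅ (subst (_≅ R' j') e Rj≅))))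

conj-quiet : ∀ {X} → Quiet (conj X) ⇔ Quiet X
conj-quiet {∞} = mk⇔ (λ ()) (λ ())
conj-quiet {∞̄} = mk⇔ (λ ()) (λ ())
conj-quiet {node m L n R} = mk⇔
  (λ (¬lc , ¬rc) → (λ (i , e) → ¬rc (i , cong conj e)) , (λ (j , e) → ¬lc (j , cong conj e)))
  (λ (¬lc , ¬rc) → (λ (j , e) → ¬rc (j , conj≡∞ e)) , (λ (i , e) → ¬lc (i , conj≡∞̄ e)))

settle : Bool → ValueSet → ValueSet
settle true S = nonCancelling (mex S)
settle false S = S

-- v ∈ᵇ leftWins A is to mean: Left, moving first, wins A ⊕ X for quiet
-- affine impartial X of value v.  Against a check there is no time to play in
-- X, so only A's own options count; a quiet A acts like its value.
leftWins rightWins leftOptions rightOptions : Form → ValueSet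
leftWins ∞ = full
leftWins ∞̄ = empty
leftWins X@(node _ _ _ _) = settle (does (quiet? X)) (leftOptions X)
rightWins ∞ = empty
rightWins ∞̄ = full
rightWins X@(node _ _ _ _) = settle (does (quiet? X)) (rightOptions X)
leftOptions (node m L n R) = ⋃ m λ i → ∁ rightWins (L i)
leftOptions _ = empty
rightOptions (node m L n R) = ⋃ n λ j → ∁ leftWins (R j)
rightOptions _ = empty

value : Form → Value
value X = mex (leftOptions X)

leftWins-quiet : ∀ {X} → Quiet X → leftWins X ≡ nonCancelling (value X)
leftWins-quiet {X@(node _ _ _ _)} quiet = cong (λ b → settle b (leftOptions X)) (dec-true (quiet? X) quiet)

rightWins-quiet : ∀ {X} → Quiet X → rightWins X ≡ nonCancelling (mex (rightOptions X))
rightWins-quiet {X@(node _ _ _ _)} quiet = cong (λ b → settle b (rightOptions X)) (dec-true (quiet? X) quiet)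

leftWins-loud : ∀ {X} → IsNode X → ¬ Quiet X → leftWins X ≡ leftOptions X
leftWins-loud {X} is-node loud = cong (λ b → settle b (leftOptions X)) (dec-false (quiet? X) loud)

rightWins-loud : ∀ {X} → IsNode X → ¬ Quiet X → rightWins X ≡ rightOptions X
rightWins-loud {X} is-node loud = cong (λ b → settle b (rightOptions X)) (dec-false (quiet? X) loud)

settle-cong : ∀ {b c S T} → b ≡ c → S ≈ T → settle b S ≈ settle c T
settle-cong {true} refl S≈T v = cong (λ a → v ∈ᵇ nonCancelling a) (mex-cong S≈T)
settle-cong {false} refl S≈T = S≈T

≅-wins : ∀ {X Y} → X ≅ Y → (leftWins X ≈ leftWins Y) × (rightWins X ≈ rightWins Y)
≅-wins {∞} {∞} _ = (λ _ → refl) , (λ _ → refl)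
≅-wins {∞̄} {∞̄} _ = (λ _ → refl) , (λ _ → refl)
≅-wins {node m L n R} {node m' L' n' R'} X≅Y@(L→L' , L'→L , R→R' , R'→R) =
  settle-cong sameQuietness
    (⋃-match (λ i → let (i' , e) = L→L' i in i' , ∁-cong (proj₂ (≅-wins e)))
             (λ i' → let (i , e) = L'→L i' in i , ∁-cong (proj₂ (≅-wins e)))) ,
  settle-cong sameQuietness
    (⋃-match (λ j → let (j' , e) = R→R' j in j' , ∁-cong (proj₁ (≅-wins e)))
             (λ j' → let (j , e) = R'→R j' in j , ∁-cong (proj₁ (≅-wins e))))
  where
  sameQuietness : does (quiet? (node m L n R)) ≡ does (quiet? (node m' L' n' R'))
  sameQuietness = does-⇔ (≅-quiet X≅Y) (quiet? _) (quiet? _)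

conj-wins : ∀ X → (leftWins (conj X) ≈ rightWins X) × (rightWins (conj X) ≈ leftWins X)
conj-wins ∞ = (λ _ → refl) , (λ _ → refl)
conj-wins ∞̄ = (λ _ → refl) , (λ _ → refl)
conj-wins (node m L n R) =
  settle-cong sameQuietness (⋃-cong λ j → ∁-cong (proj₂ (conj-wins (R j)))) ,
  settle-cong sameQuietness (⋃-cong λ i → ∁-cong (proj₁ (conj-wins (L i))))
  where
  sameQuietness : does (quiet? (conj (node m L n R))) ≡ does (quiet? (node m L n R))
  sameQuietness = does-⇔ (conj-quiet {node m L n R}) (quiet? _) (quiet? _)

symmetric-options : ∀ {X} → Symmetric X → rightOptions X ≈ leftOptions X
symmetric-options {node m L n R} (R→L , L→R) =
  ⋃-match (λ j → let (i , e) = R→L j in i , mirrored e) (λ i → let (j , e) = L→R i in j , mirrored e)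
  where
  mirrored : ∀ {i j} → R j ≅ conj (L i) → ∁ leftWins (R j) ≈ ∁ rightWins (L i)
  mirrored {i} e = ∁-cong (≈-trans (proj₁ (≅-wins e)) (proj₁ (conj-wins (L i))))

value-isMex-right : ∀ {X} → QuietFollowersSym X → Quiet X → IsMex (rightOptions X) (value X)
value-isMex-right {node m L n R} (sym-if-quiet , _) quiet =
  IsMex-≈ (≈-sym (symmetric-options (sym-if-quiet quiet))) (mex-isMex _)

rightWins-value : ∀ {X} → QuietFollowersSym X → Quiet X → rightWins X ≡ nonCancelling (value X)
rightWins-value qfs quiet =
  trans (rightWins-quiet quiet) (cong nonCancelling (IsMex-unique (mex-isMex _) (value-isMex-right qfs quiet)))

leftCheck-move : ∀ {m} {L : Fin m → Form} Y → (∃ λ i → L i ≡ ∞) →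
  anyFin m (λ i → not (rightWinsFirst (L i ⊕ Y))) ≡ true
leftCheck-move Y (i , Li≡∞) = anyFin-intro i (cong (λ Z → not (rightWinsFirst (Z ⊕ Y))) Li≡∞)

∞̄⊕ : ∀ {Y} → Y ≢ ∞ → ∞̄ ⊕ Y ≡ ∞̄
∞̄⊕ {∞} Y≢∞ = ⊥-elim (Y≢∞ refl)
∞̄⊕ {∞̄} _ = refl
∞̄⊕ {node _ _ _ _} _ = refl

rightCheck-move : ∀ {n} {R : Fin n → Form} {Y} → Y ≢ ∞ → (∃ λ j → R j ≡ ∞̄) →
  anyFin n (λ j → not (leftWinsFirst (R j ⊕ Y))) ≡ true
rightCheck-move {Y = Y} Y≢∞ (j , Rj≡∞̄) =
  anyFin-intro j (cong (not ∘ leftWinsFirst) (trans (cong (_⊕ Y) Rj≡∞̄) (∞̄⊕ Y≢∞)))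

leftCheck-⊕ : ∀ {X Y} → LeftCheck X → Y ≢ ∞̄ → leftWinsFirst (X ⊕ Y) ≡ true
leftCheck-⊕ {node _ _ _ _} {∞} _ _ = refl
leftCheck-⊕ {node _ _ _ _} {∞̄} _ Y≢∞̄ = ⊥-elim (Y≢∞̄ refl)
leftCheck-⊕ {node m L n R} {Y@(node m' L' n' R')} lc _ =
  trans (leftWinsFirst-⊕ m L n R m' L' n' R')
    (cong (_∨ anyFin m' (λ i → not (rightWinsFirst (node m L n R ⊕ L' i)))) (leftCheck-move Y lc))

rightCheck-⊕ : ∀ {X Y} → RightCheck X → Y ≢ ∞ → rightWinsFirst (X ⊕ Y) ≡ true
rightCheck-⊕ {node _ _ _ _} {∞} _ Y≢∞ = ⊥-elim (Y≢∞ refl)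
rightCheck-⊕ {node _ _ _ _} {∞̄} _ _ = refl
rightCheck-⊕ {node m L n R} {node m' L' n' R'} rc _ =
  trans (rightWinsFirst-⊕ m L n R m' L' n' R')
    (cong (_∨ anyFin n' (λ j → not (leftWinsFirst (node m L n R ⊕ R' j)))) (rightCheck-move (λ ()) rc))

DecidedByValue : Form → Form → Set
DecidedByValue A X =
  (leftWinsFirst (A ⊕ X) ≡ value X ∈ᵇ leftWins A) × (rightWinsFirst (A ⊕ X) ≡ value X ∈ᵇ rightWins A)

options-decided : ∀ v {m} {f : Fin m → Bool} (S : Fin m → ValueSet) →
  (∀ i → f i ≡ v ∈ᵇ S i) → anyFin m (λ i → not (f i)) ≡ v ∈ᵇ ⋃ m (λ i → ∁ S i)
options-decided v {m} S f≡ =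
  trans (anyFin-cong λ i → trans (cong not (f≡ i)) (sym (∈-∁ v (S i)))) (sym (∈-⋃ v m _))

module _ {m n m' n' : ℕ} {L : Fin m → Form} {R : Fin n → Form} {L' : Fin m' → Form} {R' : Fin n' → Form} where
  private
    A X : Form
    A = node m L n R
    X = node m' L' n' R'

  leftWinsFirst-⊕-quiet : Quiet X →
    (∀ i → DecidedByValue (L i) X) → (Quiet A → ∀ i → DecidedByValue (L' i) A) →
    leftWinsFirst (A ⊕ X) ≡ value X ∈ᵇ leftWins A
  leftWinsFirst-⊕-quiet (noLeftCheckX , _) byL byL' = trans (leftWinsFirst-⊕ m L n R m' L' n' R') (by (quiet? A))
    where
    inA inX : Bool
    inA = anyFin m λ i → not (rightWinsFirst (L i ⊕ X))
    inX = anyFin m' λ i → not (rightWinsFirst (A ⊕ L' i))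
    inA-decided : inA ≡ value X ∈ᵇ leftOptions A
    inA-decided = options-decided (value X) (rightWins ∘ L) (proj₂ ∘ byL)
    by : Dec (Quiet A) → (inA ∨ inX) ≡ value X ∈ᵇ leftWins A
    by (yes quietA) = begin
      inA ∨ inX                                          ≡⟨ cong₂ _∨_ inA-decided inX-decided ⟩
      value X ∈ᵇ leftOptions A ∨ value A ∈ᵇ leftOptions X ≡⟨ mex-duel (mex-isMex (leftOptions A)) (mex-isMex (leftOptions X)) ⟩
      not (cancels (value A) (value X))                  ≡⟨ ∈-nonCancelling (value A) (value X) ⟨
      value X ∈ᵇ nonCancelling (value A)                 ≡⟨ cong (value X ∈ᵇ_) (leftWins-quiet quietA) ⟨
      value X ∈ᵇ leftWins A                              ∎
      where
      open ≡-Reasoning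
      inX-decided : inX ≡ value A ∈ᵇ leftOptions X
      inX-decided = options-decided (value A) (rightWins ∘ L') λ i → trans (proj₂ (⊕-comm-wins A (L' i))) (proj₂ (byL' quietA i))
    by (no loudA) = trans (∨-redundant (Sum.map (leftCheck-move X) rightCheckA (¬Quiet⇒check loudA)))
                          (trans inA-decided (cong (value X ∈ᵇ_) (sym (leftWins-loud is-node loudA))))
      where
      rightCheckA : RightCheck A → inX ≡ false
      rightCheckA rc = anyFin-false λ i → cong not (rightCheck-⊕ rc λ e → noLeftCheckX (i , e))

  rightWinsFirst-⊕-quiet : QuietFollowersSym A → QuietFollowersSym X → Quiet X →
    (∀ j → DecidedByValue (R j) X) → (Quiet A → ∀ j → DecidedByValue (R' j) A) →
    rightWinsFirst (A ⊕ X) ≡ value X ∈ᵇ rightWins A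
  rightWinsFirst-⊕-quiet qfsA qfsX quietX@(_ , noRightCheckX) byR byR' =
    trans (rightWinsFirst-⊕ m L n R m' L' n' R') (by (quiet? A))
    where
    inA inX : Bool
    inA = anyFin n λ j → not (leftWinsFirst (R j ⊕ X))
    inX = anyFin n' λ j → not (leftWinsFirst (A ⊕ R' j))
    inA-decided : inA ≡ value X ∈ᵇ rightOptions A
    inA-decided = options-decided (value X) (leftWins ∘ R) (proj₁ ∘ byR)
    by : Dec (Quiet A) → (inA ∨ inX) ≡ value X ∈ᵇ rightWins A
    by (yes quietA) = begin
      inA ∨ inX                                            ≡⟨ cong₂ _∨_ inA-decided inX-decided ⟩
      value X ∈ᵇ rightOptions A ∨ value A ∈ᵇ rightOptions X ≡⟨ mex-duel (value-isMex-right qfsA quietA)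
                                                                         (value-isMex-right qfsX quietX) ⟩
      not (cancels (value A) (value X))                    ≡⟨ ∈-nonCancelling (value A) (value X) ⟨
      value X ∈ᵇ nonCancelling (value A)                   ≡⟨ cong (value X ∈ᵇ_) (rightWins-value qfsA quietA) ⟨
      value X ∈ᵇ rightWins A                               ∎
      where
      open ≡-Reasoning
      inX-decided : inX ≡ value A ∈ᵇ rightOptions X
      inX-decided = options-decided (value A) (leftWins ∘ R') λ j → trans (proj₁ (⊕-comm-wins A (R' j))) (proj₁ (byR' quietA j))
    by (no loudA) = trans (∨-redundant (Sum.swap (Sum.map leftCheckA (rightCheck-move (λ ())) (¬Quiet⇒check loudA))))
                          (trans inA-decided (cong (value X ∈ᵇ_) (sym (rightWins-loud is-node loudA))))
      where
      leftCheckA : LeftCheck A → inX ≡ false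
      leftCheckA lc = anyFin-false λ j → cong not (leftCheck-⊕ lc λ e → noRightCheckX (j , e))

decidedByValue : ∀ A X → QuietFollowersSym A → QuietFollowersSym X → Quiet X → DecidedByValue A X
decidedByValue ∞ X@(node _ _ _ _) _ _ _ = sym (∈-full (value X)) , sym (∈-empty (value X))
decidedByValue ∞̄ X@(node _ _ _ _) _ _ _ = sym (∈-empty (value X)) , sym (∈-full (value X))
decidedByValue A@(node m L n R) X@(node m' L' n' R') qfsA@(_ , qfsL , qfsR) qfsX@(_ , qfsL' , qfsR') quietX =
  leftWinsFirst-⊕-quiet quietX
    (λ i → decidedByValue (L i) X (qfsL i) qfsX quietX)
    (λ quietA i → decidedByValue (L' i) A (qfsL' i) qfsA quietA) ,
  rightWinsFirst-⊕-quiet qfsA qfsX quietX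
    (λ j → decidedByValue (R j) X (qfsR j) qfsX quietX)
    (λ quietA j → decidedByValue (R' j) A (qfsR' j) qfsA quietA)

𝓝-if : Bool → Outcome
𝓝-if true = 𝓝
𝓝-if false = 𝓟

outcome-𝓝-if : ∀ G {b} → leftWinsFirst G ≡ b → rightWinsFirst G ≡ b → outcome G ≡ 𝓝-if b
outcome-𝓝-if G l r with leftWinsFirst G | rightWinsFirst G
outcome-𝓝-if _ refl refl | true | true = refl
outcome-𝓝-if _ refl refl | false | false = refl

outcome-quiet-⊕-quiet : ∀ {A X} → QuietFollowersSym A → Quiet A → QuietFollowersSym X → Quiet X →
  outcome (A ⊕ X) ≡ 𝓝-if (not (cancels (value A) (value X)))
outcome-quiet-⊕-quiet {A} {X} qfsA quietA qfsX quietX =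
  let (left , right) = decidedByValue A X qfsA qfsX quietX in
  outcome-𝓝-if (A ⊕ X)
    (trans left (trans (cong (value X ∈ᵇ_) (leftWins-quiet quietA)) (∈-nonCancelling (value A) (value X))))
    (trans right (trans (cong (value X ∈ᵇ_) (rightWins-value qfsA quietA)) (∈-nonCancelling (value A) (value X))))

Checks : Form → Set
Checks X = LeftCheck X × RightCheck X

outcome-checks-⊕ : ∀ {X Y} → Checks X → IsNode Y → outcome (X ⊕ Y) ≡ 𝓝
outcome-checks-⊕ {X} {Y} (lc , rc) nodeY =
  outcome-𝓝-if (X ⊕ Y) (leftCheck-⊕ lc (IsNode⇒≢∞̄ nodeY)) (rightCheck-⊕ rc (IsNode⇒≢∞ nodeY))

outcome-⊕-checks : ∀ {X Y} → IsNode X → Checks Y → outcome (X ⊕ Y) ≡ 𝓝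
outcome-⊕-checks {X} {Y} nodeX (lc , rc) = outcome-𝓝-if (X ⊕ Y)
  (trans (proj₁ (⊕-comm-wins X Y)) (leftCheck-⊕ lc (IsNode⇒≢∞̄ nodeX)))
  (trans (proj₂ (⊕-comm-wins X Y)) (rightCheck-⊕ rc (IsNode⇒≢∞ nodeX)))

Checks⇒IsNode : ∀ {X} → Checks X → IsNode X
Checks⇒IsNode {node _ _ _ _} _ = is-node

symmetric-quiet-or-checks : ∀ {X} → Symmetric X → Quiet X ⊎ Checks X
symmetric-quiet-or-checks {node m L n R} (R→L , L→R) with quiet? (node m L n R)
... | yes quiet = inj₁ quiet
... | no loud = inj₂ ([ fromLeft , fromRight ] (¬Quiet⇒check loud))
  where
  fromLeft : LeftCheck (node m L n R) → Checks (node m L n R)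
  fromLeft (i , Li≡∞) = let (j , e) = L→R i in (i , Li≡∞) , (j , ≅∞̄ (subst (λ Z → R j ≅ conj Z) Li≡∞ e))
  fromRight : RightCheck (node m L n R) → Checks (node m L n R)
  fromRight (j , Rj≡∞̄) = let (i , e) = R→L j in (i , conj≡∞̄ (∞̄≅ (subst (_≅ conj (L i)) Rj≡∞̄ e))) , (j , Rj≡∞̄)

≡Im-if-quiet-agree : ∀ {G H} → IsNode G → IsNode H →
  (∀ X → QuietFollowersSym X → Quiet X → outcome (G ⊕ X) ≡ outcome (H ⊕ X)) → G ≡Im H
≡Im-if-quiet-agree nodeG nodeH agree X (symX , qfsX) with symmetric-quiet-or-checks symX
... | inj₁ quietX = agree X qfsX quietX
... | inj₂ checksX = trans (outcome-⊕-checks nodeG checksX) (sym (outcome-⊕-checks nodeH checksX))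

≡Im-if-same-value : ∀ {G H} → QuietFollowersSym G → Quiet G → QuietFollowersSym H → Quiet H →
  value G ≡ value H → G ≡Im H
≡Im-if-same-value qfsG quietG qfsH quietH sameValue =
  ≡Im-if-quiet-agree (Quiet⇒IsNode quietG) (Quiet⇒IsNode quietH) λ X qfsX quietX →
    trans (outcome-quiet-⊕-quiet qfsG quietG qfsX quietX)
      (trans (cong (λ v → 𝓝-if (not (cancels v (value X)))) sameValue)
        (sym (outcome-quiet-⊕-quiet qfsH quietH qfsX quietX)))

moon-checks : Checks moon
moon-checks = (zero , refl) , (zero , refl)

≡Im-moon-if-moon-value : ∀ {G} → QuietFollowersSym G → Quiet G → value G ≡ nothing → G ≡Im moon
≡Im-moon-if-moon-value qfsG quietG moonValue =
  ≡Im-if-quiet-agree (Quiet⇒IsNode quietG) is-node λ X qfsX quietX →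
    trans (outcome-quiet-⊕-quiet qfsG quietG qfsX quietX)
      (trans (cong (λ v → 𝓝-if (not (cancels v (value X)))) moonValue)
        (sym (outcome-checks-⊕ moon-checks (Quiet⇒IsNode quietX))))

≡Im-moon-if-checks : ∀ {G} → Checks G → G ≡Im moon
≡Im-moon-if-checks checksG =
  ≡Im-if-quiet-agree (Checks⇒IsNode checksG) is-node λ X _ quietX →
    trans (outcome-checks-⊕ checksG (Quiet⇒IsNode quietX)) (sym (outcome-checks-⊕ moon-checks (Quiet⇒IsNode quietX)))

nim-induction : (P : Form → Set) → P (nim 0) → (∀ k → (∀ i → P (nimOpts k i)) → P (nim (suc k))) →
  ∀ k → P (nim k)
nimOpts-induction : (P : Form → Set) → P (nim 0) → (∀ k → (∀ i → P (nimOpts k i)) → P (nim (suc k))) →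
  ∀ k i → P (nimOpts k i)
nim-induction P base step zero = base
nim-induction P base step (suc k) = step k (nimOpts-induction P base step k)
nimOpts-induction P base step k zero = nim-induction P base step k
nimOpts-induction P base step (suc k) (suc i) = nimOpts-induction P base step k i

nimOpts-all : (P : Form → Set) → (∀ k → P (nim k)) → ∀ k i → P (nimOpts k i)
nimOpts-all P all = nimOpts-induction P (all 0) (λ k _ → all (suc k))

mirror-selfConjugate : ∀ {m} {O : Fin m → Form} → (∀ i → O i ≅ conj (O i)) → node m O m O ≅ conj (node m O m O)
mirror-selfConjugate O≅ = (λ i → i , O≅ i) , (λ i → i , O≅ i) , (λ i → i , O≅ i) , (λ i → i , O≅ i)

mirror-symmetric : ∀ {m} {O : Fin m → Form} → (∀ i → O i ≅ conj (O i)) → Symmetric (node m O m O)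
mirror-symmetric O≅ = (λ j → j , O≅ j) , (λ i → i , O≅ i)

nimOpts-selfConjugate : ∀ k i → nimOpts k i ≅ conj (nimOpts k i)
nimOpts-selfConjugate = nimOpts-induction (λ X → X ≅ conj X) (ends , ends , ends , ends) (λ _ → mirror-selfConjugate)
  where
  ends : Fin 1 → Σ (Fin 1) λ _ → ⊤
  ends _ = zero , tt

nim-symmetric : ∀ k → Symmetric (nim k)
nim-symmetric zero = (λ _ → zero , tt) , (λ _ → zero , tt)
nim-symmetric (suc k) = mirror-symmetric (nimOpts-selfConjugate k)

nim-qfs : ∀ k → QuietFollowersSym (nim k)
nim-qfs = nim-induction QuietFollowersSym
  ((λ _ → nim-symmetric 0) , (λ _ → tt) , (λ _ → tt))
  (λ k opts → (λ _ → nim-symmetric (suc k)) , opts , opts)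

nim-isNode : ∀ k → IsNode (nim k)
nim-isNode zero = is-node
nim-isNode (suc k) = is-node

nim-quiet : ∀ k → Quiet (nim k)
nim-quiet zero = (λ { (_ , ()) }) , (λ { (_ , ()) })
nim-quiet (suc k) =
  (λ (i , e) → IsNode⇒≢∞ (nimOpts-all IsNode nim-isNode k i) e) , (λ (j , e) → IsNode⇒≢∞̄ (nimOpts-all IsNode nim-isNode k j) e)

∈-leftOptions-quiet : ∀ {m L n R} → (∀ i → QuietFollowersSym (L i)) → (∀ i → Quiet (L i)) →
  ∀ v → v ∈ᵇ leftOptions (node m L n R) ≡ anyFin m (λ i → cancels (value (L i)) v)
∈-leftOptions-quiet {m} {L} qfs quiet v = trans (∈-⋃ v m _) (anyFin-cong λ i → begin
  v ∈ᵇ ∁ rightWins (L i)                    ≡⟨ ∈-∁ v (rightWins (L i)) ⟩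
  not (v ∈ᵇ rightWins (L i))                ≡⟨ cong (λ S → not (v ∈ᵇ S)) (rightWins-value (qfs i) (quiet i)) ⟩
  not (v ∈ᵇ nonCancelling (value (L i)))    ≡⟨ cong not (∈-nonCancelling (value (L i)) v) ⟩
  not (not (cancels (value (L i)) v))       ≡⟨ not-involutive _ ⟩
  cancels (value (L i)) v                   ∎)
  where open ≡-Reasoning

nim-value-step : ∀ k → (∀ i → value (nimOpts k i) ≡ just (k ∸ toℕ i)) → value (nim (suc k)) ≡ just (suc k)
nim-value-step k optionValues = IsMex-unique (mex-isMex (leftOptions (nim (suc k)))) (mex-nat suc-k∉ below-in)
  where
  member : ∀ j → just j ∈ᵇ leftOptions (nim (suc k)) ≡ anyFin (suc k) (λ i → does (k ∸ toℕ i ≟ j))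
  member j = trans (∈-leftOptions-quiet {L = nimOpts k} {R = nimOpts k} (nimOpts-all QuietFollowersSym nim-qfs k) (nimOpts-all Quiet nim-quiet k) (just j))
                   (anyFin-cong λ i → cong (λ v → cancels v (just j)) (optionValues i))
  suc-k∉ : just (suc k) ∈ᵇ leftOptions (nim (suc k)) ≡ false
  suc-k∉ = trans (member (suc k)) (anyFin-false {m = suc k} {f = λ i → does (k ∸ toℕ i ≟ suc k)} λ i → dec-false (_ ≟ _) (<⇒≢ (s≤s (m∸n≤m k (toℕ i)))))
  below-in : ∀ {j} → j < suc k → just j ∈ᵇ leftOptions (nim (suc k)) ≡ true
  below-in {j} (s≤s j≤k) = trans (member j) (anyFin-intro {f = λ i → does (k ∸ toℕ i ≟ j)} (fromℕ< (s≤s (m∸n≤m k j)))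
    (dec-true (_ ≟ _) (trans (cong (k ∸_) (toℕ-fromℕ< (s≤s (m∸n≤m k j)))) (m∸[m∸n]≡n j≤k))))

nimOpts-value : ∀ k i → value (nimOpts k i) ≡ just (k ∸ toℕ i)
nimOpts-value zero zero = refl
nimOpts-value (suc k) zero = nim-value-step k (nimOpts-value k)
nimOpts-value (suc k) (suc i) = nimOpts-value k i

nim-value : ∀ k → value (nim k) ≡ just k
nim-value k = nimOpts-value k zero

theorem3p20 : (G : Form) → IsImp G → (∃ λ n → G ≡Im nim n) ⊎ (G ≡Im moon)
theorem3p20 G (symG , qfsG) with symmetric-quiet-or-checks symG
... | inj₂ checksG = inj₂ (≡Im-moon-if-checks checksG)
... | inj₁ quietG with value G in valueG
...   | just k = inj₁ (k , ≡Im-if-same-value qfsG quietG (nim-qfs k) (nim-quiet k) (trans valueG (sym (nim-value k))))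
...   | nothing = inj₂ (≡Im-moon-if-moon-value qfsG quietG valueG)
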